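{- Let $c$ be a proper edge coloring of $K_n=(V,E)$ and let $P=(p_1,\dots,p_k)$ be a maximum rainbow path (a rainbow path with the largest possible number of vertices). Then $c(p_1,V(P)^c)\subseteq c(P)$ and $c(p_k,V(P)^c)\subseteq c(P)$. In particular, $|A(P)| = |\Gamma_{\mathrm{new}}(p_1,P)| \geq n-k$ and $|B(P)| = |\Gamma_{\mathrm{new}}(p_k,P)| \geq n-k$.
   Context: A proper edge coloring of a graph $G=(V,E)$ is a map $c\colon E\to\mathbb{N}$ such that any two distinct edges sharing an endpoint receive different colors; a path is rainbow if no two of its edges have the same color. For a path $P$, $c(P)$ denotes the set of colors on the edges of $P$, $V(P)^c = V\setminus V(P)$, and for a vertex $v$ and a vertex set $S$, $c(v,S)$ is the set of colors of the edges $\{v,s\}$, $s\in S$. For a rainbow path $P$ and a vertex $v$, $\Gamma_{\mathrm{new}}(v,P)=\{u\in V\setminus\{v\} : c(u,v)\notin c(P)\}$. For $P=(p_1,\dots,p_k)$, $A(P)=\{p_i\in V(P): i<k,\ p_{i+1}\in \Gamma_{\mathrm{new}}(p_1,P)\}$ and $B(P)=\{p_i\in V(P): i>1,\ p_{i-1}\in\Gamma_{\mathrm{new}}(p_k,P)\}$. -}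

module Defs where

open import Data.Nat using (ℕ; suc; _≤_)
open import Data.Fin using (Fin)
open import Data.Fin.Properties using (_≟_)
open import Data.Nat.Properties using () renaming (_≟_ to _≟ℕ_)
open import Data.List using (List; []; _∷_; length; filter; allFin; map)
open import Data.List.Membership.Propositional using (_∈_; _∉_)
open import Data.List.Membership.DecPropositional _≟ℕ_ using () renaming (_∈?_ to _∈ℕ?_)
open import Data.List.Relation.Unary.Unique.Propositional using (Unique)
open import Data.Product using (_×_; Σ; _,_)
open import Relation.Binary.PropositionalEquality using (_≡_; _≢_)
open import Relation.Nullary using (¬_; Dec; yes; no)
open import Relation.Nullary.Decidable using (_×-dec_; ¬?; ⌊_⌋)
open import Data.Bool using (Bool; if_then_else_)

-- An edge colouring of K_n on V = Fin n: a colour c u v for every pair;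
-- only the values with u ≢ v (the edges) matter.  Symmetric, since edges
-- are unordered.
record ProperColoring (n : ℕ) : Set where
  field
    col    : Fin n → Fin n → ℕ
    sym    : ∀ u v → col u v ≡ col v u
    proper : ∀ u v w → u ≢ v → u ≢ w → v ≢ w → col u v ≢ col u w
open ProperColoring public

-- A path is a non-empty list of distinct vertices (p₁ ∷ rest); in K_n
-- every pair of distinct vertices is an edge.
record Path (n : ℕ) : Set where
  constructor path
  field
    first : Fin n
    rest  : List (Fin n)
    distinct : Unique (first ∷ rest)
open Path public

vertices : ∀ {n} → Path n → List (Fin n)
vertices P = first P ∷ rest P

size : ∀ {n} → Path n → ℕ
size P = length (vertices P)

colsFrom : ∀ {n} → (Fin n → Fin n → ℕ) → Fin n → List (Fin n) → List ℕ
colsFrom c x []       = []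
colsFrom c x (y ∷ ys) = c x y ∷ colsFrom c y ys

colors : ∀ {n} → ProperColoring n → Path n → List ℕ
colors c P = colsFrom (col c) (first P) (rest P)

Rainbow : ∀ {n} → ProperColoring n → Path n → Set
Rainbow c P = Unique (colors c P)

MaximumRainbow : ∀ {n} → ProperColoring n → Path n → Set
MaximumRainbow c P = Rainbow c P × (∀ Q → Rainbow c Q → size Q ≤ size P)

lastV : ∀ {n} → Fin n → List (Fin n) → Fin n
lastV x []       = x
lastV x (y ∷ ys) = lastV y ys

lastVertex : ∀ {n} → Path n → Fin n
lastVertex P = lastV (first P) (rest P)

outside : ∀ {n} → Path n → List (Fin n)
outside {n} P = filter (λ u → ¬? (u ∈? vertices P)) (allFin n)
  where open import Data.List.Membership.DecPropositional (_≟_ {n}) using (_∈?_)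

ColorsIn : ∀ {n} → ProperColoring n → Fin n → List (Fin n) → List ℕ → Set
ColorsIn c v S C = ∀ s → s ∈ S → col c v s ∈ C

Γnew : ∀ {n} → ProperColoring n → Fin n → Path n → List (Fin n)
Γnew {n} c v P =
  filter (λ u → ¬? (u ≟ v) ×-dec ¬? (col c u v ∈ℕ? colors c P)) (allFin n)

-- A(P) = { p_i : i < k, p_{i+1} ∈ Γ_new(p_1,P) }: walk consecutive pairs
-- (p_i , p_{i+1}) and keep p_i when p_{i+1} satisfies the condition.
keepPred : ∀ {n} → (Fin n → Bool) → Fin n → List (Fin n) → List (Fin n)
keepPred p x []       = []
keepPred p x (y ∷ ys) = if p y then x ∷ keepPred p y ys else keepPred p y ys

-- B(P) = { p_i : i > 1, p_{i-1} ∈ Γ_new(p_k,P) }: keep p_i when p_{i-1}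
-- satisfies the condition.
keepSucc : ∀ {n} → (Fin n → Bool) → Fin n → List (Fin n) → List (Fin n)
keepSucc p x []       = []
keepSucc p x (y ∷ ys) = if p x then y ∷ keepSucc p y ys else keepSucc p y ys

inΓnew : ∀ {n} → ProperColoring n → Fin n → Path n → Fin n → Bool
inΓnew c v P u = ⌊ ¬? (u ≟ v) ×-dec ¬? (col c u v ∈ℕ? colors c P) ⌋

A : ∀ {n} → ProperColoring n → Path n → List (Fin n)
A c P = keepPred (inΓnew c (first P) P) (first P) (rest P)

B : ∀ {n} → ProperColoring n → Path n → List (Fin n)
B c P = keepSucc (inΓnew c (lastVertex P) P) (first P) (rest P)

-- If the colour of an edge from an endpoint of P to a vertex s outside P were
-- missing from c(P), then s could be attached at that end, giving a longer
-- rainbow path.  Hence every vertex u with a new colour c(u, p₁) lies on P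
-- (and is not p₁), so A(P), which is Γ_new(p₁, P) ∩ {p₂, …, p_k} shifted by
-- one position, has the size of Γ_new(p₁, P); symmetrically for B(P).  For the
-- lower bound: by properness the vertices u ≠ v with c(u, v) ∈ c(P) are at
-- most |c(P)| = k − 1, so together with v they miss at most n − k vertices,
-- all of which lie in Γ_new(v, P).
module Submission where

open import Defs
open import Data.Nat using (ℕ; suc; _≤_; z≤n; s≤s; _∸_; _+_)
open import Data.Nat.Properties using (1+n≰n; ≤-antisym; +-comm; m≤n+o⇒m∸n≤o; +-monoˡ-≤; module ≤-Reasoning)
  renaming (_≟_ to _≟ℕ_)
open import Data.Fin using (Fin)
open import Data.Fin.Properties using (_≟_)
open import Data.List using (List; []; _∷_; _++_; _∷ʳ_; length; map; filter; allFin)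
open import Data.List.Properties using (length-++; length-map; length-tabulate)
open import Data.List.Membership.Propositional using (_∈_; _∉_)
open import Data.List.Membership.Propositional.Properties
  using (∈-filter⁺; ∈-filter⁻; ∈-allFin; ∈-++⁺ˡ; ∈-++⁺ʳ; ∈-map⁻)
open import Data.List.Membership.DecPropositional _≟ℕ_ using () renaming (_∈?_ to _∈ℕ?_)
open import Data.List.Relation.Binary.Subset.Propositional using (_⊆_)
open import Data.List.Relation.Binary.Subset.Propositional.Properties using (filter⁺′)
open import Data.List.Relation.Unary.Any using (here; there)
import Data.List.Relation.Unary.All as All
import Data.List.Relation.Unary.All.Properties as All
open import Data.List.Relation.Unary.Unique.Propositional using (Unique; []; _∷_)
open import Data.List.Relation.Unary.Unique.Propositional.Properties using (++⁺; filter⁺; allFin⁺; drop⁺)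
open import Data.Product using (_×_; _,_; proj₁; proj₂; ∃-syntax)
open import Data.Empty using (⊥-elim)
open import Function using (id)
open import Relation.Binary.PropositionalEquality
  using (_≡_; _≢_; refl; trans; cong; subst) renaming (sym to ≡-sym)
open import Relation.Nullary using (¬_; yes; no)
open import Relation.Nullary.Decidable using (_×-dec_; ¬?; ⌊_⌋; decidable-stable)
open import Relation.Unary using (Pred; Decidable)
open import Level using (0ℓ)

module _ {A : Set} where

  ∈-remove : ∀ {y : A} {ys} → y ∈ ys →
    ∃[ zs ] length ys ≡ suc (length zs) × (∀ {z} → z ∈ ys → z ≢ y → z ∈ zs)
  ∈-remove {ys = _ ∷ ys} (here refl) =
    ys , refl , λ { (here z≡y) z≢y → ⊥-elim (z≢y z≡y) ; (there z∈ys) _ → z∈ys }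
  ∈-remove {ys = y′ ∷ ys} (there y∈ys) with zs , eq , keep ← ∈-remove y∈ys =
    y′ ∷ zs , cong suc eq , λ { (here z≡y′) _ → here z≡y′ ; (there z∈ys) z≢y → there (keep z∈ys z≢y) }

  Unique-⊆⇒length≤ : ∀ {xs ys : List A} → Unique xs → xs ⊆ ys → length xs ≤ length ys
  Unique-⊆⇒length≤ [] _ = z≤n
  Unique-⊆⇒length≤ {x ∷ xs} {ys} (x∉xs ∷ uxs) xs⊆ys
    with zs , eq , keep ← ∈-remove (xs⊆ys (here refl)) =
    subst (suc (length xs) ≤_) (≡-sym eq) (s≤s (Unique-⊆⇒length≤ uxs xs⊆zs))
    where
    xs⊆zs : xs ⊆ zs
    xs⊆zs z∈xs = keep (xs⊆ys (there z∈xs)) λ z≡x → All.lookup x∉xs z∈xs (≡-sym z≡x)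

  Unique-⊆-antisym⇒length≡ : ∀ {xs ys : List A} → Unique xs → Unique ys →
    xs ⊆ ys → ys ⊆ xs → length xs ≡ length ys
  Unique-⊆-antisym⇒length≡ uxs uys xs⊆ys ys⊆xs =
    ≤-antisym (Unique-⊆⇒length≤ uxs xs⊆ys) (Unique-⊆⇒length≤ uys ys⊆xs)

  Unique-map⁺-injectiveOn : {B : Set} {f : A → B} {xs : List A} →
    (∀ {a b} → a ∈ xs → b ∈ xs → f a ≡ f b → a ≡ b) → Unique xs → Unique (map f xs)
  Unique-map⁺-injectiveOn inj [] = []
  Unique-map⁺-injectiveOn inj (x∉xs ∷ uxs) =
    All.map⁺ (All.tabulate λ y∈xs fx≡fy → All.lookup x∉xs y∈xs (inj (here refl) (there y∈xs) fx≡fy))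
    ∷ Unique-map⁺-injectiveOn (λ a∈ b∈ → inj (there a∈) (there b∈)) uxs

  module _ {P : Pred A 0ℓ} (P? : Decidable P) where

    length-filter-≡ : ∀ {xs ys} → Unique xs → Unique ys →
      xs ⊆ ys → filter P? ys ⊆ xs → length (filter P? xs) ≡ length (filter P? ys)
    length-filter-≡ {ys = ys} uxs uys xs⊆ys Pys⊆xs =
      Unique-⊆-antisym⇒length≡ (filter⁺ P? uxs) (filter⁺ P? uys) (filter⁺′ P? P? id xs⊆ys)
        λ z∈Pys → ∈-filter⁺ P? (Pys⊆xs z∈Pys) (proj₂ (∈-filter⁻ P? {xs = ys} z∈Pys))

module _ {n : ℕ} where
  open import Data.List.Membership.DecPropositional (_≟_ {n}) using (_∈?_)

  colsFrom-length : ∀ (f : Fin n → Fin n → ℕ) x ys → length (colsFrom f x ys) ≡ length ys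
  colsFrom-length f x [] = refl
  colsFrom-length f x (y ∷ ys) = cong suc (colsFrom-length f y ys)

  colsFrom-∷ʳ : ∀ (f : Fin n → Fin n → ℕ) x ys s →
    colsFrom f x (ys ∷ʳ s) ≡ colsFrom f x ys ∷ʳ f (lastV x ys) s
  colsFrom-∷ʳ f x [] s = refl
  colsFrom-∷ʳ f x (y ∷ ys) s = cong (f x y ∷_) (colsFrom-∷ʳ f y ys s)

  module _ {D : Pred (Fin n) 0ℓ} (D? : Decidable D) where

    keepPred-length : ∀ x ys → length (keepPred (λ u → ⌊ D? u ⌋) x ys) ≡ length (filter D? ys)
    keepPred-length x [] = refl
    keepPred-length x (y ∷ ys) with D? y
    ... | yes _ = cong suc (keepPred-length y ys)
    ... | no  _ = keepPred-length y ys

    keepSucc-length : ∀ x ys → ¬ D (lastV x ys) →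
      length (keepSucc (λ u → ⌊ D? u ⌋) x ys) ≡ length (filter D? (x ∷ ys))
    keepSucc-length x [] ¬Dx with D? x
    ... | yes Dx = ⊥-elim (¬Dx Dx)
    ... | no  _  = refl
    keepSucc-length x (y ∷ ys) ¬Dlast with D? x
    ... | yes _ = cong suc (keepSucc-length y ys ¬Dlast)
    ... | no  _ = keepSucc-length y ys ¬Dlast

  ∈-outside⁺ : ∀ P {s} → s ∉ vertices P → s ∈ outside P
  ∈-outside⁺ P {s} s∉P = ∈-filter⁺ (λ u → ¬? (u ∈? vertices P)) (∈-allFin s) s∉P

  ∈-outside⁻ : ∀ P {s} → s ∈ outside P → s ∉ vertices P
  ∈-outside⁻ P s∈out = proj₂ (∈-filter⁻ (λ u → ¬? (u ∈? vertices P)) {xs = allFin n} s∈out)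

  prepend : (s : Fin n) (P : Path n) → s ∉ vertices P → Path n
  prepend s P s∉P = path s (vertices P) (All.¬Any⇒All¬ (vertices P) s∉P ∷ distinct P)

  append : (P : Path n) (s : Fin n) → s ∉ vertices P → Path n
  append P s s∉P = path (first P) (rest P ∷ʳ s)
    (++⁺ (distinct P) (All.[] ∷ []) λ { (s∈P , here refl) → s∉P s∈P })

  size-append : ∀ P s (s∉P : s ∉ vertices P) → size (append P s s∉P) ≡ suc (size P)
  size-append P s s∉P = cong suc (trans (length-++ (rest P)) (+-comm (length (rest P)) 1))

module _ {n : ℕ} (c : ProperColoring n) where
  open import Data.List.Membership.DecPropositional (_≟_ {n}) using (_∈?_)

  prepend-rainbow : ∀ {P s} (s∉P : s ∉ vertices P) → Rainbow c P →
    col c s (first P) ∉ colors c P → Rainbow c (prepend s P s∉P)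
  prepend-rainbow s∉P rP new = All.¬Any⇒All¬ _ new ∷ rP

  append-rainbow : ∀ {P s} (s∉P : s ∉ vertices P) → Rainbow c P →
    col c (lastVertex P) s ∉ colors c P → Rainbow c (append P s s∉P)
  append-rainbow {P} {s} s∉P rP new =
    subst Unique (≡-sym (colsFrom-∷ʳ (col c) (first P) (rest P) s))
      (++⁺ rP (All.[] ∷ []) λ { (old , here refl) → new old })

  maximum-size-≢ : ∀ {P} Q → MaximumRainbow c P → Rainbow c Q → size Q ≢ suc (size P)
  maximum-size-≢ {P} Q (_ , maximal) rQ eq = 1+n≰n (subst (_≤ size P) eq (maximal Q rQ))

  first-colorsIn : ∀ P → MaximumRainbow c P → ColorsIn c (first P) (outside P) (colors c P)
  first-colorsIn P max s s∈out = decidable-stable (col c (first P) s ∈ℕ? colors c P) λ new →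
    maximum-size-≢ {P} (prepend s P s∉P) max
      (prepend-rainbow {P} s∉P (proj₁ max) λ old → new (subst (_∈ colors c P) (sym c s (first P)) old))
      refl
    where
    s∉P : s ∉ vertices P
    s∉P = ∈-outside⁻ P s∈out

  last-colorsIn : ∀ P → MaximumRainbow c P → ColorsIn c (lastVertex P) (outside P) (colors c P)
  last-colorsIn P max s s∈out = decidable-stable (col c (lastVertex P) s ∈ℕ? colors c P) λ new →
    maximum-size-≢ {P} (append P s s∉P) max (append-rainbow {P} s∉P (proj₁ max) new) (size-append P s s∉P)
    where
    s∉P : s ∉ vertices P
    s∉P = ∈-outside⁻ P s∈out

  new? : ∀ v P → Decidable (λ u → u ≢ v × col c u v ∉ colors c P)
  new? v P u = ¬? (u ≟ v) ×-dec ¬? (col c u v ∈ℕ? colors c P)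

  old? : ∀ v P → Decidable (λ u → u ≢ v × col c u v ∈ colors c P)
  old? v P u = ¬? (u ≟ v) ×-dec (col c u v ∈ℕ? colors c P)

  ∈-Γnew⁻ : ∀ {v P u} → u ∈ Γnew c v P → u ≢ v × col c u v ∉ colors c P
  ∈-Γnew⁻ {v} {P} u∈Γ = proj₂ (∈-filter⁻ (new? v P) {xs = allFin n} u∈Γ)

  old-length≤ : ∀ v P → length (filter (old? v P) (allFin n)) ≤ length (colors c P)
  old-length≤ v P = begin
    length olds                   ≡⟨ length-map colourAt-v olds ⟨
    length (map colourAt-v olds)  ≤⟨ Unique-⊆⇒length≤ uniqueColours oldColours ⟩
    length (colors c P)           ∎
    where
    open ≤-Reasoning
    olds : List (Fin n)
    olds = filter (old? v P) (allFin n)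
    colourAt-v : Fin n → ℕ
    colourAt-v u = col c u v
    isOld : ∀ {u} → u ∈ olds → u ≢ v × col c u v ∈ colors c P
    isOld u∈olds = proj₂ (∈-filter⁻ (old? v P) {xs = allFin n} u∈olds)
    injective : ∀ {a b} → a ∈ olds → b ∈ olds → colourAt-v a ≡ colourAt-v b → a ≡ b
    injective a∈ b∈ same = decidable-stable (_ ≟ _) λ a≢b →
      proper c v _ _ (λ v≡a → proj₁ (isOld a∈) (≡-sym v≡a)) (λ v≡b → proj₁ (isOld b∈) (≡-sym v≡b)) a≢b
        (trans (sym c v _) (trans same (sym c _ v)))
    uniqueColours : Unique (map colourAt-v olds)
    uniqueColours = Unique-map⁺-injectiveOn injective (filter⁺ (old? v P) (allFin⁺ n))
    oldColours : map colourAt-v olds ⊆ colors c P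
    oldColours m with u , u∈olds , refl ← ∈-map⁻ colourAt-v m = proj₂ (isOld u∈olds)

  allFin-⊆-old-new : ∀ v P → allFin n ⊆ (v ∷ filter (old? v P) (allFin n)) ++ Γnew c v P
  allFin-⊆-old-new v P {u} _ with u ≟ v | col c u v ∈ℕ? colors c P
  ... | yes refl | _       = here refl
  ... | no u≢v   | yes old = there (∈-++⁺ˡ (∈-filter⁺ (old? v P) (∈-allFin u) (u≢v , old)))
  ... | no u≢v   | no new  = ∈-++⁺ʳ (v ∷ _) (∈-filter⁺ (new? v P) (∈-allFin u) (u≢v , new))

  Γnew-lowerBound : ∀ v P → n ∸ size P ≤ length (Γnew c v P)
  Γnew-lowerBound v P = m≤n+o⇒m∸n≤o n (size P) (begin
    n                                 ≡⟨ length-tabulate id ⟨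
    length (allFin n)                 ≤⟨ Unique-⊆⇒length≤ (allFin⁺ n) (allFin-⊆-old-new v P) ⟩
    length ((v ∷ olds) ++ Γ)          ≡⟨ length-++ (v ∷ olds) ⟩
    suc (length olds) + length Γ      ≤⟨ +-monoˡ-≤ (length Γ) (s≤s (old-length≤ v P)) ⟩
    suc (length (colors c P)) + length Γ
      ≡⟨ cong (λ k → suc k + length Γ) (colsFrom-length (col c) (first P) (rest P)) ⟩
    size P + length Γ                 ∎)
    where
    open ≤-Reasoning
    olds Γ : List (Fin n)
    olds = filter (old? v P) (allFin n)
    Γ = Γnew c v P

  Γnew-⊆-vertices : ∀ v P → ColorsIn c v (outside P) (colors c P) → Γnew c v P ⊆ vertices P
  Γnew-⊆-vertices v P outsideOld {u} u∈Γ = decidable-stable (u ∈? vertices P) λ u∉P →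
    proj₂ (∈-Γnew⁻ {v} {P} u∈Γ) (subst (_∈ colors c P) (sym c v u) (outsideOld u (∈-outside⁺ P u∉P)))

  A-length : ∀ P → ColorsIn c (first P) (outside P) (colors c P) →
    length (A c P) ≡ length (Γnew c (first P) P)
  A-length P outsideOld = trans (keepPred-length (new? (first P) P) (first P) (rest P))
    (length-filter-≡ (new? (first P) P) (drop⁺ 1 (distinct P)) (allFin⁺ n) (λ {u} _ → ∈-allFin u) Γnew⊆rest)
    where
    Γnew⊆rest : Γnew c (first P) P ⊆ rest P
    Γnew⊆rest u∈Γ with Γnew-⊆-vertices (first P) P outsideOld u∈Γ
    ... | here u≡p₁   = ⊥-elim (proj₁ (∈-Γnew⁻ {first P} {P} u∈Γ) u≡p₁)
    ... | there u∈rest = u∈rest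

  B-length : ∀ P → ColorsIn c (lastVertex P) (outside P) (colors c P) →
    length (B c P) ≡ length (Γnew c (lastVertex P) P)
  B-length P outsideOld =
    trans (keepSucc-length (new? (lastVertex P) P) (first P) (rest P) λ new → proj₁ new refl)
      (length-filter-≡ (new? (lastVertex P) P) (distinct P) (allFin⁺ n) (λ {u} _ → ∈-allFin u)
        (Γnew-⊆-vertices (lastVertex P) P outsideOld))

proposition1 : (n : ℕ) (c : ProperColoring n) (P : Path n) → MaximumRainbow c P →
    (ColorsIn c (first P) (outside P) (colors c P)
      × ColorsIn c (lastVertex P) (outside P) (colors c P))
    × (length (A c P) ≡ length (Γnew c (first P) P)
      × n ∸ size P ≤ length (Γnew c (first P) P))
    × (length (B c P) ≡ length (Γnew c (lastVertex P) P)
      × n ∸ size P ≤ length (Γnew c (lastVertex P) P))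
proposition1 n c P max =
  (firstOld , lastOld) ,
  (A-length c P firstOld , Γnew-lowerBound c (first P) P) ,
  (B-length c P lastOld , Γnew-lowerBound c (lastVertex P) P)
  where
  firstOld : ColorsIn c (first P) (outside P) (colors c P)
  firstOld = first-colorsIn c P max
  lastOld : ColorsIn c (lastVertex P) (outside P) (colors c P)
  lastOld = last-colorsIn c P max
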